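{- For every integer $n\ge 3$, the complete bipartite graph $K_{n,n}$ has a $3$-null $1$-factorisation.
   Context: For a graph $G$ and positive integer $k$, a zero-sum $k$-flow of $G$ is a map $f:E(G)\to\{\pm1,\dots,\pm(k-1)\}$ such that the sum of $f$ over the edges incident with any vertex is $0$. A $1$-factorisation is a partition of $E(G)$ into $1$-factors (perfect matchings). $G$ has a $k$-null $1$-factorisation if there is a zero-sum $k$-flow $f$ of $G$ and a $1$-factorisation of $G$ in which every $1$-factor has weight zero, the weight of an edge set being the sum of the $f$-values of its edges. -}

module Defs where

open import Data.Nat using (ℕ; zero; suc; _≤_; _<_)
open import Data.Integer using (ℤ; _+_; ∣_∣; 0ℤ)
open import Data.Fin using (Fin; zero; suc; _≟_)
open import Data.Product using (Σ; _×_; ∃; ∃-syntax)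
open import Relation.Nullary using (does)
open import Data.Bool using (if_then_else_)
open import Relation.Binary.PropositionalEquality using (_≡_)

sumFin : (n : ℕ) → (Fin n → ℤ) → ℤ
sumFin zero    g = 0ℤ
sumFin (suc n) g = g zero + sumFin n (λ i → g (suc i))

-- The complete bipartite graph K_{n,n}: vertices are the left copy of Fin n
-- and the right copy of Fin n; edges are exactly the pairs (i , j) with
-- i on the left and j on the right.  Edge-functions are thus Fin n → Fin n → A.

FlowValue : ℕ → ℤ → Set
FlowValue k x = (1 ≤ ∣ x ∣) × (∣ x ∣ < k)

IsZeroSumFlow : (n k : ℕ) → (Fin n → Fin n → ℤ) → Set
IsZeroSumFlow n k f =
  ((i j : Fin n) → FlowValue k (f i j))
  × ((i : Fin n) → sumFin n (λ j → f i j) ≡ 0ℤ)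
  × ((j : Fin n) → sumFin n (λ i → f i j) ≡ 0ℤ)

IsOneFactorisation : (n m : ℕ) → (Fin n → Fin n → Fin m) → Set
IsOneFactorisation n m c =
  (t : Fin m) →
    ((i : Fin n) → ∃[ j ] (c i j ≡ t × ((j' : Fin n) → c i j' ≡ t → j' ≡ j)))
  × ((j : Fin n) → ∃[ i ] (c i j ≡ t × ((i' : Fin n) → c i' j ≡ t → i' ≡ i)))

classWeight : (n m : ℕ) → (Fin n → Fin n → ℤ) → (Fin n → Fin n → Fin m) → Fin m → ℤ
classWeight n m f c t =
  sumFin n (λ i → sumFin n (λ j → if does (c i j ≟ t) then f i j else 0ℤ))

HasNullOneFactorisation : (n k : ℕ) → Set
HasNullOneFactorisation n k =
  Σ (Fin n → Fin n → ℤ) λ f →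
  Σ ℕ λ m →
  Σ (Fin n → Fin n → Fin m) λ c →
    IsZeroSumFlow n k f
    × IsOneFactorisation n m c
    × ((t : Fin m) → classWeight n m f c t ≡ 0ℤ)

-- Colour the edge (x, y) of K_{n,n} by x + y mod n; the colour classes {(x, t - x)} are 1-factors,
-- so it suffices to find a zero-sum 3-flow whose rows, columns and "diagonals" x + y ≡ t all sum
-- to zero.  Fix a sequence ψ with values in {±1, ±2} summing to zero over one period.  For odd n
-- take ψ(2x + y mod n): as 2 is invertible mod n, every row, column and diagonal runs through all
-- residues once.  For n = 2k take (-1)^y ψ(⌊x/2⌋) with ψ of length k: rows alternate in sign,
-- columns meet every value of ψ twice with the same sign, and along a diagonal the sign is
-- (-1)^(t + x), so consecutive pairs cancel.
module Submission where

open import Defs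
open import Data.Nat as ℕ using (ℕ; zero; suc; _≤_; _<_; _∸_; _%_; _/_; NonZero; z≤n; s≤s; ⌊_/2⌋)
import Data.Nat.Properties as ℕₚ
open import Data.Nat.DivMod using (_mod_; m≡m%n+[m/n]*n; m%n<n; m<n⇒m%n≡m; %-remove-+ˡ; %-distribˡ-+; m%n%n≡m%n)
open import Data.Nat.Divisibility using (∣-refl)
open import Data.Nat.Tactic.RingSolver using (solve-∀)
open import Data.Integer.Tactic.RingSolver renaming (solve-∀ to ℤsolve-∀)
open import Data.Integer using (ℤ; 0ℤ; 1ℤ; -1ℤ; -[1+_]; _+_; _*_; -_; _^_; ∣_∣)
import Data.Integer.Properties as ℤₚ
open import Algebra.Properties.AbelianGroup ℤₚ.+-0-abelianGroup using (∙-cancelˡ)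
open import Data.Fin using (Fin; zero; suc; toℕ; _≟_)
import Data.Fin.Properties as Finₚ
open import Data.Product using (_×_; _,_; ∃-syntax)
open import Data.Sum using (_⊎_; inj₁; inj₂)
open import Data.Bool using (if_then_else_)
open import Relation.Nullary using (¬_; does)
open import Relation.Nullary.Decidable using (dec-true; dec-false)
open import Relation.Unary using (Pred; Decidable)
open import Level using (0ℓ)
open import Relation.Binary.PropositionalEquality

open ≡-Reasoning

sumFin-cong : ∀ n {g h : Fin n → ℤ} → (∀ i → g i ≡ h i) → sumFin n g ≡ sumFin n h
sumFin-cong zero    eq = refl
sumFin-cong (suc n) eq = cong₂ _+_ (eq zero) (sumFin-cong n (λ i → eq (suc i)))

sumFin-if-none : ∀ {n} {P : Pred (Fin n) 0ℓ} (P? : Decidable P) (g : Fin n → ℤ) →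
                 (∀ j → ¬ P j) → sumFin n (λ j → if does (P? j) then g j else 0ℤ) ≡ 0ℤ
sumFin-if-none {zero}  P? g none = refl
sumFin-if-none {suc n} P? g none rewrite dec-false (P? zero) (none zero) =
  trans (ℤₚ.+-identityˡ _) (sumFin-if-none (λ j → P? (suc j)) (λ j → g (suc j)) (λ j → none (suc j)))

sumFin-if-unique : ∀ {n} {P : Pred (Fin n) 0ℓ} (P? : Decidable P) (g : Fin n → ℤ) {j₀ : Fin n} →
                   P j₀ → (∀ j → P j → j ≡ j₀) →
                   sumFin n (λ j → if does (P? j) then g j else 0ℤ) ≡ g j₀
sumFin-if-unique {suc n} P? g {zero} p unique rewrite dec-true (P? zero) p = begin
  g zero + sumFin n (λ j → if does (P? (suc j)) then g (suc j) else 0ℤ)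
    ≡⟨ cong (g zero +_) (sumFin-if-none (λ j → P? (suc j)) (λ j → g (suc j))
                                 (λ j q → Finₚ.0≢1+n (sym (unique (suc j) q)))) ⟩
  g zero + 0ℤ
    ≡⟨ ℤₚ.+-identityʳ _ ⟩
  g zero ∎
sumFin-if-unique {suc n} P? g {suc j₀} p unique
  rewrite dec-false (P? zero) (λ q → Finₚ.0≢1+n (unique zero q)) =
  trans (ℤₚ.+-identityˡ _) (sumFin-if-unique (λ j → P? (suc j)) (λ j → g (suc j)) p
                                              (λ j q → Finₚ.suc-injective (unique (suc j) q)))

sumTo : ℕ → (ℕ → ℤ) → ℤ
sumTo n G = sumFin n (λ i → G (toℕ i))

sumTo-cong : ∀ n {G H : ℕ → ℤ} → (∀ x → x < n → G x ≡ H x) → sumTo n G ≡ sumTo n H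
sumTo-cong n eq = sumFin-cong n (λ i → eq (toℕ i) (Finₚ.toℕ<n i))

sumTo-zero : ∀ n {G : ℕ → ℤ} → (∀ x → x < n → G x ≡ 0ℤ) → sumTo n G ≡ 0ℤ
sumTo-zero zero    eq = refl
sumTo-zero (suc n) eq = cong₂ _+_ (eq 0 ℕ.z<s) (sumTo-zero n (λ x x<n → eq (suc x) (s≤s x<n)))

sumTo-snoc : ∀ n (G : ℕ → ℤ) → sumTo (suc n) G ≡ sumTo n G + G n
sumTo-snoc zero    G = ℤₚ.+-comm (G 0) 0ℤ
sumTo-snoc (suc n) G = trans (cong (G 0 +_) (sumTo-snoc n (λ x → G (suc x))))
                             (sym (ℤₚ.+-assoc (G 0) _ _))

sumTo-+ : ∀ m n (G : ℕ → ℤ) → sumTo (m ℕ.+ n) G ≡ sumTo m G + sumTo n (λ y → G (m ℕ.+ y))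
sumTo-+ zero    n G = sym (ℤₚ.+-identityˡ _)
sumTo-+ (suc m) n G = trans (cong (G 0 +_) (sumTo-+ m n (λ x → G (suc x))))
                            (sym (ℤₚ.+-assoc (G 0) _ _))

sumTo-distrib-+ : ∀ n (G H : ℕ → ℤ) → sumTo n (λ x → G x + H x) ≡ sumTo n G + sumTo n H
sumTo-distrib-+ zero    G H = refl
sumTo-distrib-+ (suc n) G H =
  trans (cong (G 0 + H 0 +_) (sumTo-distrib-+ n (λ x → G (suc x)) (λ x → H (suc x))))
        (interchange (G 0) (H 0) _ _)
  where
  interchange : ∀ a b c d → (a + b) + (c + d) ≡ (a + c) + (b + d)
  interchange = ℤsolve-∀

sumTo-*ˡ : ∀ n a (G : ℕ → ℤ) → sumTo n (λ x → a * G x) ≡ a * sumTo n G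
sumTo-*ˡ zero    a G = sym (ℤₚ.*-zeroʳ a)
sumTo-*ˡ (suc n) a G = trans (cong (a * G 0 +_) (sumTo-*ˡ n a (λ x → G (suc x))))
                             (sym (ℤₚ.*-distribˡ-+ a (G 0) _))

sumTo-pairs : ∀ k (G : ℕ → ℤ) → sumTo (k ℕ.* 2) G ≡ sumTo k (λ x → G (x ℕ.* 2) + G (suc (x ℕ.* 2)))
sumTo-pairs zero    G = refl
sumTo-pairs (suc k) G = trans (cong (λ s → G 0 + (G 1 + s)) (sumTo-pairs k (λ x → G (suc (suc x)))))
                              (sym (ℤₚ.+-assoc (G 0) (G 1) _))

Periodic : ℕ → (ℕ → ℤ) → Set
Periodic n G = ∀ x → G (n ℕ.+ x) ≡ G x

module _ {n : ℕ} {G : ℕ → ℤ} (periodic : Periodic n G) where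

  periodic-translate : ∀ a → Periodic n (λ x → G (a ℕ.+ x))
  periodic-translate a x = trans (cong G (swap a n x)) (periodic (a ℕ.+ x))
    where
    swap : ∀ a n x → a ℕ.+ (n ℕ.+ x) ≡ n ℕ.+ (a ℕ.+ x)
    swap = solve-∀

  periodic-*+ : ∀ k x → G (k ℕ.* n ℕ.+ x) ≡ G x
  periodic-*+ zero    x = refl
  periodic-*+ (suc k) x = begin
    G (n ℕ.+ k ℕ.* n ℕ.+ x)   ≡⟨ cong G (ℕₚ.+-assoc n (k ℕ.* n) x) ⟩
    G (n ℕ.+ (k ℕ.* n ℕ.+ x)) ≡⟨ periodic _ ⟩
    G (k ℕ.* n ℕ.+ x)         ≡⟨ periodic-*+ k x ⟩
    G x                       ∎

  periodic-% : .{{_ : NonZero n}} → ∀ x → G (x % n) ≡ G x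
  periodic-% x = begin
    G (x % n)                   ≡⟨ periodic-*+ (x / n) (x % n) ⟨
    G (x / n ℕ.* n ℕ.+ x % n)   ≡⟨ cong G (ℕₚ.+-comm (x / n ℕ.* n) (x % n)) ⟩
    G (x % n ℕ.+ x / n ℕ.* n)   ≡⟨ cong G (m≡m%n+[m/n]*n x n) ⟨
    G x                         ∎

  sumTo-shift : sumTo n (λ x → G (suc x)) ≡ sumTo n G
  sumTo-shift = ∙-cancelˡ (G 0) _ _ (begin
    G 0 + sumTo n (λ x → G (suc x))  ≡⟨ sumTo-snoc n G ⟩
    sumTo n G + G n                  ≡⟨ cong (λ y → sumTo n G + G y) (ℕₚ.+-identityʳ n) ⟨
    sumTo n G + G (n ℕ.+ 0)          ≡⟨ cong (sumTo n G +_) (periodic 0) ⟩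
    sumTo n G + G 0                  ≡⟨ ℤₚ.+-comm (sumTo n G) (G 0) ⟩
    G 0 + sumTo n G                  ∎)

sumTo-rotate : ∀ {n} {G : ℕ → ℤ} → Periodic n G → ∀ a → sumTo n (λ x → G (a ℕ.+ x)) ≡ sumTo n G
sumTo-rotate periodic zero    = refl
sumTo-rotate periodic (suc a) =
  trans (sumTo-rotate (periodic-translate periodic 1) a) (sumTo-shift periodic)

sumTo-double : ∀ m {G : ℕ → ℤ} → Periodic (suc (m ℕ.* 2)) G →
               sumTo (suc (m ℕ.* 2)) (λ x → G (x ℕ.* 2)) ≡ sumTo (suc (m ℕ.* 2)) G
-- The doubled indices 2x with x ≤ m are the even residues; the last m of them wrap around to the odd ones.
sumTo-double m {G} periodic = begin
  sumTo n (λ x → G (x ℕ.* 2))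
    ≡⟨ cong (λ k → sumTo k (λ x → G (x ℕ.* 2))) (split m) ⟩
  sumTo (suc m ℕ.+ m) (λ x → G (x ℕ.* 2))
    ≡⟨ sumTo-+ (suc m) m (λ x → G (x ℕ.* 2)) ⟩
  (G 0 + evens) + sumTo m (λ y → G ((suc m ℕ.+ y) ℕ.* 2))
    ≡⟨ cong ((G 0 + evens) +_) (sumTo-cong m (λ y _ → wrap y)) ⟩
  (G 0 + evens) + odds
    ≡⟨ reorder (G 0) evens odds ⟩
  G 0 + (odds + evens)
    ≡⟨ cong (G 0 +_) (sumTo-distrib-+ m (λ y → G (suc (y ℕ.* 2))) (λ y → G (suc (suc (y ℕ.* 2))))) ⟨
  G 0 + sumTo m (λ y → G (suc (y ℕ.* 2)) + G (suc (suc (y ℕ.* 2))))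
    ≡⟨ cong (G 0 +_) (sumTo-pairs m (λ x → G (suc x))) ⟨
  sumTo n G ∎
  where
  n = suc (m ℕ.* 2)
  evens = sumTo m (λ y → G (suc (suc (y ℕ.* 2))))
  odds  = sumTo m (λ y → G (suc (y ℕ.* 2)))
  split : ∀ m → suc (m ℕ.* 2) ≡ suc m ℕ.+ m
  split = solve-∀
  unfold : ∀ m y → (suc m ℕ.+ y) ℕ.* 2 ≡ suc (m ℕ.* 2) ℕ.+ suc (y ℕ.* 2)
  unfold = solve-∀
  wrap : ∀ y → G ((suc m ℕ.+ y) ℕ.* 2) ≡ G (suc (y ℕ.* 2))
  wrap y = trans (cong G (unfold m y)) (periodic _)
  reorder : ∀ a e o → (a + e) + o ≡ a + (o + e)
  reorder = ℤsolve-∀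

m+[o+[n∸m]]≡n+o : ∀ {m n} o → m ≤ n → m ℕ.+ (o ℕ.+ (n ∸ m)) ≡ n ℕ.+ o
m+[o+[n∸m]]≡n+o {m} {n} o m≤n = begin
  m ℕ.+ (o ℕ.+ (n ∸ m))   ≡⟨ cong (m ℕ.+_) (ℕₚ.+-comm o (n ∸ m)) ⟩
  m ℕ.+ ((n ∸ m) ℕ.+ o)   ≡⟨ ℕₚ.+-assoc m (n ∸ m) o ⟨
  m ℕ.+ (n ∸ m) ℕ.+ o     ≡⟨ cong (ℕ._+ o) (ℕₚ.m+[n∸m]≡n m≤n) ⟩
  n ℕ.+ o                 ∎

module _ {n : ℕ} .{{_ : NonZero n}} where

  toℕ-mod : ∀ m → toℕ (m mod n) ≡ m % n
  toℕ-mod m = Finₚ.toℕ-fromℕ< (m%n<n m n)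

  %-absorbˡ : ∀ a b → (a % n ℕ.+ b) % n ≡ (a ℕ.+ b) % n
  %-absorbˡ a b = begin
    (a % n ℕ.+ b) % n             ≡⟨ %-distribˡ-+ (a % n) b n ⟩
    (a % n % n ℕ.+ b % n) % n     ≡⟨ cong (λ r → (r ℕ.+ b % n) % n) (m%n%n≡m%n a n) ⟩
    (a % n ℕ.+ b % n) % n         ≡⟨ %-distribˡ-+ a b n ⟨
    (a ℕ.+ b) % n                 ∎

  %-absorbʳ : ∀ a b → (a ℕ.+ b % n) % n ≡ (a ℕ.+ b) % n
  %-absorbʳ a b = begin
    (a ℕ.+ b % n) % n   ≡⟨ cong (_% n) (ℕₚ.+-comm a (b % n)) ⟩
    (b % n ℕ.+ a) % n   ≡⟨ %-absorbˡ b a ⟩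
    (b ℕ.+ a) % n       ≡⟨ cong (_% n) (ℕₚ.+-comm b a) ⟩
    (a ℕ.+ b) % n       ∎

  [n+m]%n≡m%n : ∀ m → (n ℕ.+ m) % n ≡ m % n
  [n+m]%n≡m%n m = %-remove-+ˡ m ∣-refl

module _ (n : ℕ) .{{_ : NonZero n}} where

  cyclicColouring : Fin n → Fin n → Fin n
  cyclicColouring i j = (toℕ i ℕ.+ toℕ j) mod n

  -- t - i mod n, written with n ∸ i since ∸ truncates.
  cyclicPartner : Fin n → Fin n → Fin n
  cyclicPartner t i = (toℕ t ℕ.+ (n ∸ toℕ i)) mod n

module _ {n : ℕ} .{{_ : NonZero n}} where

  private
    toℕ≤n : (i : Fin n) → toℕ i ≤ n
    toℕ≤n i = ℕₚ.<⇒≤ (Finₚ.toℕ<n i)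

  cyclicColouring-partner : ∀ t i → cyclicColouring n i (cyclicPartner n t i) ≡ t
  cyclicColouring-partner t i = Finₚ.toℕ-injective (begin
    toℕ ((x ℕ.+ toℕ ((toℕ t ℕ.+ (n ∸ x)) mod n)) mod n)  ≡⟨ toℕ-mod _ ⟩
    (x ℕ.+ toℕ ((toℕ t ℕ.+ (n ∸ x)) mod n)) % n         ≡⟨ cong (λ y → (x ℕ.+ y) % n) (toℕ-mod _) ⟩
    (x ℕ.+ (toℕ t ℕ.+ (n ∸ x)) % n) % n                 ≡⟨ %-absorbʳ x _ ⟩
    (x ℕ.+ (toℕ t ℕ.+ (n ∸ x))) % n                     ≡⟨ cong (_% n) (m+[o+[n∸m]]≡n+o (toℕ t) (toℕ≤n i)) ⟩
    (n ℕ.+ toℕ t) % n                                   ≡⟨ [n+m]%n≡m%n (toℕ t) ⟩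
    toℕ t % n                                           ≡⟨ m<n⇒m%n≡m (Finₚ.toℕ<n t) ⟩
    toℕ t                                               ∎)
    where x = toℕ i

  cyclicPartner-unique : ∀ t i j → cyclicColouring n i j ≡ t → j ≡ cyclicPartner n t i
  cyclicPartner-unique t i j colour≡t = Finₚ.toℕ-injective (begin
    y                                  ≡⟨ m<n⇒m%n≡m (Finₚ.toℕ<n j) ⟨
    y % n                              ≡⟨ [n+m]%n≡m%n y ⟨
    (n ℕ.+ y) % n                      ≡⟨ cong (_% n) (m+[o+[n∸m]]≡n+o y (toℕ≤n i)) ⟨
    (x ℕ.+ (y ℕ.+ (n ∸ x))) % n        ≡⟨ cong (_% n) (ℕₚ.+-assoc x y (n ∸ x)) ⟨
    (x ℕ.+ y ℕ.+ (n ∸ x)) % n          ≡⟨ %-absorbˡ (x ℕ.+ y) (n ∸ x) ⟨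
    ((x ℕ.+ y) % n ℕ.+ (n ∸ x)) % n    ≡⟨ cong (λ r → (r ℕ.+ (n ∸ x)) % n) x+y%n≡t ⟩
    (toℕ t ℕ.+ (n ∸ x)) % n            ≡⟨ toℕ-mod _ ⟨
    toℕ (cyclicPartner n t i)          ∎)
    where
    x = toℕ i
    y = toℕ j
    x+y%n≡t : (x ℕ.+ y) % n ≡ toℕ t
    x+y%n≡t = trans (sym (toℕ-mod (x ℕ.+ y))) (cong toℕ colour≡t)

  cyclicColouring-comm : ∀ i j → cyclicColouring n i j ≡ cyclicColouring n j i
  cyclicColouring-comm i j = cong (_mod n) (ℕₚ.+-comm (toℕ i) (toℕ j))

  cyclicOneFactorisation : IsOneFactorisation n n (cyclicColouring n)
  cyclicOneFactorisation t =
      (λ i → cyclicPartner n t i , cyclicColouring-partner t i , λ j → cyclicPartner-unique t i j)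
    , (λ j → cyclicPartner n t j
           , trans (cyclicColouring-comm _ j) (cyclicColouring-partner t j)
           , λ i colour≡t → cyclicPartner-unique t j i (trans (cyclicColouring-comm j i) colour≡t))

-- flow x y is the value on the edge (x, y) of K_{n,n}, extended n-periodically in y, so that the
-- 1-factor t = {(x, t - x mod n)} of the cyclic colouring is read off as the diagonal y = t + (n ∸ x).
record NullCyclicFlow (n k : ℕ) : Set where
  field
    flow           : ℕ → ℕ → ℤ
    flow-value     : ∀ x y → FlowValue k (flow x y)
    flow-periodic  : ∀ x → Periodic n (flow x)
    sumTo-row      : ∀ x → sumTo n (flow x) ≡ 0ℤ
    sumTo-column   : ∀ y → sumTo n (λ x → flow x y) ≡ 0ℤ
    sumTo-diagonal : ∀ t → sumTo n (λ x → flow x (t ℕ.+ (n ∸ x))) ≡ 0ℤ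

nullCyclicFlow⇒hasNullOneFactorisation : ∀ {n k} .{{_ : NonZero n}} →
  NullCyclicFlow n k → HasNullOneFactorisation n k
nullCyclicFlow⇒hasNullOneFactorisation {n} {k} F =
  f , n , cyclicColouring n ,
  ((λ i j → flow-value (toℕ i) (toℕ j)) , (λ i → sumTo-row (toℕ i)) , (λ j → sumTo-column (toℕ j))) ,
  cyclicOneFactorisation , classWeight≡0
  where
  open NullCyclicFlow F
  f : Fin n → Fin n → ℤ
  f i j = flow (toℕ i) (toℕ j)
  classWeight≡0 : ∀ t → classWeight n n f (cyclicColouring n) t ≡ 0ℤ
  classWeight≡0 t = begin
    classWeight n n f (cyclicColouring n) t
      ≡⟨ sumFin-cong n (λ i → sumFin-if-unique (λ j → cyclicColouring n i j ≟ t) (f i)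
                                (cyclicColouring-partner t i) (cyclicPartner-unique t i)) ⟩
    sumFin n (λ i → f i (cyclicPartner n t i))
      ≡⟨ sumFin-cong n (λ i → trans (cong (flow (toℕ i)) (toℕ-mod _))
                                    (periodic-% (flow-periodic (toℕ i)) _)) ⟩
    sumTo n (λ x → flow x (toℕ t ℕ.+ (n ∸ x)))
      ≡⟨ sumTo-diagonal (toℕ t) ⟩
    0ℤ ∎

record ZeroSumSequence (L : ℕ) : Set where
  field
    term       : ℕ → ℤ
    term-value : ∀ x → FlowValue 3 (term x)
    sumTo-term : sumTo L term ≡ 0ℤ

flowValue-1 : FlowValue 3 1ℤ
flowValue-1 = s≤s z≤n , s≤s (s≤s z≤n)

flowValue--1 : FlowValue 3 -1ℤ
flowValue--1 = s≤s z≤n , s≤s (s≤s z≤n)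

flowValue--2 : FlowValue 3 -[1+ 1 ]
flowValue--2 = s≤s z≤n , s≤s (s≤s (s≤s z≤n))

ones : ZeroSumSequence 0
ones = record { term = λ _ → 1ℤ ; term-value = λ _ → flowValue-1 ; sumTo-term = refl }

oneOneMinusTwo : ZeroSumSequence 3
oneOneMinusTwo = record { term = term ; term-value = term-value ; sumTo-term = refl }
  where
  term : ℕ → ℤ
  term 2 = -[1+ 1 ]
  term _ = 1ℤ
  term-value : ∀ x → FlowValue 3 (term x)
  term-value 0 = flowValue-1
  term-value 1 = flowValue-1
  term-value 2 = flowValue--2
  term-value (suc (suc (suc x))) = flowValue-1

prependOneMinusOne : ∀ {L} → ZeroSumSequence L → ZeroSumSequence (2 ℕ.+ L)
prependOneMinusOne {L} ψ = record
  { term = term ; term-value = term-value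
  ; sumTo-term = trans (cong (λ s → 1ℤ + (-1ℤ + s)) (ZeroSumSequence.sumTo-term ψ)) refl }
  where
  term : ℕ → ℤ
  term 0 = 1ℤ
  term 1 = -1ℤ
  term (suc (suc x)) = ZeroSumSequence.term ψ x
  term-value : ∀ x → FlowValue 3 (term x)
  term-value 0 = flowValue-1
  term-value 1 = flowValue--1
  term-value (suc (suc x)) = ZeroSumSequence.term-value ψ x

zeroSumSequence : ∀ L → 2 ≤ L → ZeroSumSequence L
zeroSumSequence 1 (s≤s ())
zeroSumSequence 2 _ = prependOneMinusOne ones
zeroSumSequence 3 _ = oneOneMinusTwo
zeroSumSequence (suc (suc (suc (suc L)))) _ = prependOneMinusOne (zeroSumSequence (suc (suc L)) (s≤s (s≤s z≤n)))

oddNullCyclicFlow : ∀ m → 1 ≤ m → NullCyclicFlow (suc (m ℕ.* 2)) 3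
oddNullCyclicFlow m 1≤m = record
  { flow           = λ x y → G (x ℕ.* 2 ℕ.+ y)
  ; flow-value     = λ x y → term-value _
  ; flow-periodic  = λ x → periodic-translate G-periodic (x ℕ.* 2)
  ; sumTo-row      = λ x → trans (sumTo-rotate G-periodic (x ℕ.* 2)) sumTo-G
  ; sumTo-column   = column
  ; sumTo-diagonal = diagonal
  }
  where
  n = suc (m ℕ.* 2)
  open ZeroSumSequence (zeroSumSequence n (ℕₚ.m≤n⇒m≤1+n (ℕₚ.*-monoˡ-≤ 2 1≤m)))
  G : ℕ → ℤ
  G x = term (x % n)
  G-periodic : Periodic n G
  G-periodic x = cong term ([n+m]%n≡m%n x)
  sumTo-G : sumTo n G ≡ 0ℤ
  sumTo-G = trans (sumTo-cong n (λ x x<n → cong term (m<n⇒m%n≡m x<n))) sumTo-term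
  column : ∀ y → sumTo n (λ x → G (x ℕ.* 2 ℕ.+ y)) ≡ 0ℤ
  column y = begin
    sumTo n (λ x → G (x ℕ.* 2 ℕ.+ y))   ≡⟨ sumTo-cong n (λ x _ → cong G (ℕₚ.+-comm (x ℕ.* 2) y)) ⟩
    sumTo n (λ x → G (y ℕ.+ x ℕ.* 2))   ≡⟨ sumTo-double m (periodic-translate G-periodic y) ⟩
    sumTo n (λ z → G (y ℕ.+ z))         ≡⟨ sumTo-rotate G-periodic y ⟩
    sumTo n G                           ≡⟨ sumTo-G ⟩
    0ℤ                                  ∎
  regroup : ∀ x t d → x ℕ.* 2 ℕ.+ (t ℕ.+ d) ≡ x ℕ.+ ((t ℕ.+ x) ℕ.+ d)
  regroup = solve-∀
  diagonal : ∀ t → sumTo n (λ x → G (x ℕ.* 2 ℕ.+ (t ℕ.+ (n ∸ x)))) ≡ 0ℤ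
  diagonal t = begin
    sumTo n (λ x → G (x ℕ.* 2 ℕ.+ (t ℕ.+ (n ∸ x))))
      ≡⟨ sumTo-cong n (λ x x<n → cong G (trans (regroup x t (n ∸ x)) (m+[o+[n∸m]]≡n+o (t ℕ.+ x) (ℕₚ.<⇒≤ x<n)))) ⟩
    sumTo n (λ x → G (n ℕ.+ (t ℕ.+ x)))
      ≡⟨ sumTo-cong n (λ x _ → G-periodic (t ℕ.+ x)) ⟩
    sumTo n (λ x → G (t ℕ.+ x))
      ≡⟨ sumTo-rotate G-periodic t ⟩
    sumTo n G
      ≡⟨ sumTo-G ⟩
    0ℤ ∎

⌊n*2/2⌋≡n : ∀ n → ⌊ n ℕ.* 2 /2⌋ ≡ n
⌊n*2/2⌋≡n zero    = refl
⌊n*2/2⌋≡n (suc n) = cong suc (⌊n*2/2⌋≡n n)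

⌊1+n*2/2⌋≡n : ∀ n → ⌊ suc (n ℕ.* 2) /2⌋ ≡ n
⌊1+n*2/2⌋≡n zero    = refl
⌊1+n*2/2⌋≡n (suc n) = cong suc (⌊1+n*2/2⌋≡n n)

-1^n*2≡1 : ∀ n → -1ℤ ^ (n ℕ.* 2) ≡ 1ℤ
-1^n*2≡1 zero    = refl
-1^n*2≡1 (suc n) = cong (λ e → -1ℤ * (-1ℤ * e)) (-1^n*2≡1 n)

-1^[1+n]*i≡-[-1^n*i] : ∀ n i → -1ℤ ^ suc n * i ≡ - (-1ℤ ^ n * i)
-1^[1+n]*i≡-[-1^n*i] n i = trans (ℤₚ.*-assoc -1ℤ (-1ℤ ^ n) i) (ℤₚ.-1*i≡-i (-1ℤ ^ n * i))

∣-1^n*i∣≡∣i∣ : ∀ n i → ∣ -1ℤ ^ n * i ∣ ≡ ∣ i ∣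
∣-1^n*i∣≡∣i∣ zero    i = cong ∣_∣ (ℤₚ.*-identityˡ i)
∣-1^n*i∣≡∣i∣ (suc n) i = begin
  ∣ -1ℤ ^ suc n * i ∣     ≡⟨ cong ∣_∣ (-1^[1+n]*i≡-[-1^n*i] n i) ⟩
  ∣ - (-1ℤ ^ n * i) ∣     ≡⟨ ℤₚ.∣-i∣≡∣i∣ (-1ℤ ^ n * i) ⟩
  ∣ -1ℤ ^ n * i ∣         ≡⟨ ∣-1^n*i∣≡∣i∣ n i ⟩
  ∣ i ∣                   ∎

-1^-parity : ∀ m n k → m ℕ.+ n ≡ k ℕ.* 2 → -1ℤ ^ m ≡ -1ℤ ^ n
-1^-parity m zero    k m+0≡2k = trans (cong (-1ℤ ^_) (trans (sym (ℕₚ.+-identityʳ m)) m+0≡2k)) (-1^n*2≡1 k)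
-1^-parity m (suc n) k m+1+n≡2k = begin
  -1ℤ ^ m                       ≡⟨ -1*[-1*i]≡i (-1ℤ ^ m) ⟨
  -1ℤ * -1ℤ ^ suc m             ≡⟨ cong (-1ℤ *_) (-1^-parity (suc m) n k (trans (sym (ℕₚ.+-suc m n)) m+1+n≡2k)) ⟩
  -1ℤ * -1ℤ ^ n                 ∎
  where
  -1*[-1*i]≡i : ∀ i → -1ℤ * (-1ℤ * i) ≡ i
  -1*[-1*i]≡i = ℤsolve-∀

sumTo-alternating : ∀ k (G : ℕ → ℤ) → sumTo (k ℕ.* 2) (λ y → -1ℤ ^ y * G ⌊ y /2⌋) ≡ 0ℤ
sumTo-alternating k G = trans (sumTo-pairs k (λ y → -1ℤ ^ y * G ⌊ y /2⌋)) (sumTo-zero k (λ x _ → begin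
  -1ℤ ^ (x ℕ.* 2) * G ⌊ x ℕ.* 2 /2⌋ + -1ℤ ^ suc (x ℕ.* 2) * G ⌊ suc (x ℕ.* 2) /2⌋
    ≡⟨ cong₂ (λ a b → -1ℤ ^ (x ℕ.* 2) * G a + -1ℤ ^ suc (x ℕ.* 2) * G b) (⌊n*2/2⌋≡n x) (⌊1+n*2/2⌋≡n x) ⟩
  -1ℤ ^ (x ℕ.* 2) * G x + -1ℤ ^ suc (x ℕ.* 2) * G x
    ≡⟨ cong (-1ℤ ^ (x ℕ.* 2) * G x +_) (-1^[1+n]*i≡-[-1^n*i] (x ℕ.* 2) (G x)) ⟩
  -1ℤ ^ (x ℕ.* 2) * G x + - (-1ℤ ^ (x ℕ.* 2) * G x)
    ≡⟨ ℤₚ.+-inverseʳ (-1ℤ ^ (x ℕ.* 2) * G x) ⟩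
  0ℤ ∎))

sumTo-⌊/2⌋ : ∀ k (G : ℕ → ℤ) → sumTo (k ℕ.* 2) (λ x → G ⌊ x /2⌋) ≡ sumTo k G + sumTo k G
sumTo-⌊/2⌋ k G = begin
  sumTo (k ℕ.* 2) (λ x → G ⌊ x /2⌋)
    ≡⟨ sumTo-pairs k (λ x → G ⌊ x /2⌋) ⟩
  sumTo k (λ x → G ⌊ x ℕ.* 2 /2⌋ + G ⌊ suc (x ℕ.* 2) /2⌋)
    ≡⟨ sumTo-cong k (λ x _ → cong₂ (λ a b → G a + G b) (⌊n*2/2⌋≡n x) (⌊1+n*2/2⌋≡n x)) ⟩
  sumTo k (λ x → G x + G x)
    ≡⟨ sumTo-distrib-+ k G G ⟩
  sumTo k G + sumTo k G ∎

evenNullCyclicFlow : ∀ k → 2 ≤ k → NullCyclicFlow (k ℕ.* 2) 3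
evenNullCyclicFlow k 2≤k = record
  { flow           = flow
  ; flow-value     = λ x y → subst (λ a → 1 ≤ a × a < 3) (sym (∣-1^n*i∣≡∣i∣ y _)) (term-value _)
  ; flow-periodic  = λ x y → cong (_* term ⌊ x /2⌋) (-1^-parity (n ℕ.+ y) y (k ℕ.+ y) (regroup k y))
  ; sumTo-row      = λ x → sumTo-alternating k (λ _ → term ⌊ x /2⌋)
  ; sumTo-column   = column
  ; sumTo-diagonal = diagonal
  }
  where
  n = k ℕ.* 2
  open ZeroSumSequence (zeroSumSequence k 2≤k)
  flow : ℕ → ℕ → ℤ
  flow x y = -1ℤ ^ y * term ⌊ x /2⌋
  regroup : ∀ k y → k ℕ.* 2 ℕ.+ y ℕ.+ y ≡ (k ℕ.+ y) ℕ.* 2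
  regroup = solve-∀
  column : ∀ y → sumTo n (λ x → flow x y) ≡ 0ℤ
  column y = begin
    sumTo n (λ x → -1ℤ ^ y * term ⌊ x /2⌋)   ≡⟨ sumTo-*ˡ n (-1ℤ ^ y) (λ x → term ⌊ x /2⌋) ⟩
    -1ℤ ^ y * sumTo n (λ x → term ⌊ x /2⌋)   ≡⟨ cong (-1ℤ ^ y *_) (sumTo-⌊/2⌋ k term) ⟩
    -1ℤ ^ y * (sumTo k term + sumTo k term)  ≡⟨ cong (λ s → -1ℤ ^ y * (s + s)) sumTo-term ⟩
    -1ℤ ^ y * 0ℤ                             ≡⟨ ℤₚ.*-zeroʳ (-1ℤ ^ y) ⟩
    0ℤ                                       ∎
  diagonal-sign : ∀ t x → x < n → -1ℤ ^ (t ℕ.+ (n ∸ x)) ≡ -1ℤ ^ t * -1ℤ ^ x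
  diagonal-sign t x x<n = trans (ℤₚ.^-distribˡ-+-* -1ℤ t (n ∸ x))
    (cong (-1ℤ ^ t *_) (-1^-parity (n ∸ x) x k (ℕₚ.m∸n+n≡m (ℕₚ.<⇒≤ x<n))))
  diagonal : ∀ t → sumTo n (λ x → flow x (t ℕ.+ (n ∸ x))) ≡ 0ℤ
  diagonal t = begin
    sumTo n (λ x → -1ℤ ^ (t ℕ.+ (n ∸ x)) * term ⌊ x /2⌋)
      ≡⟨ sumTo-cong n (λ x x<n → trans (cong (_* term ⌊ x /2⌋) (diagonal-sign t x x<n))
                                       (ℤₚ.*-assoc (-1ℤ ^ t) (-1ℤ ^ x) _)) ⟩
    sumTo n (λ x → -1ℤ ^ t * (-1ℤ ^ x * term ⌊ x /2⌋))
      ≡⟨ sumTo-*ˡ n (-1ℤ ^ t) (λ x → -1ℤ ^ x * term ⌊ x /2⌋) ⟩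
    -1ℤ ^ t * sumTo n (λ x → -1ℤ ^ x * term ⌊ x /2⌋)
      ≡⟨ cong (-1ℤ ^ t *_) (sumTo-alternating k term) ⟩
    -1ℤ ^ t * 0ℤ
      ≡⟨ ℤₚ.*-zeroʳ (-1ℤ ^ t) ⟩
    0ℤ ∎

even⊎odd : ∀ n → (∃[ k ] n ≡ k ℕ.* 2) ⊎ (∃[ m ] n ≡ suc (m ℕ.* 2))
even⊎odd zero = inj₁ (0 , refl)
even⊎odd (suc n) with even⊎odd n
... | inj₁ (k , n≡2k)   = inj₂ (k , cong suc n≡2k)
... | inj₂ (m , n≡2m+1) = inj₁ (suc m , cong suc n≡2m+1)

nullCyclicFlow : ∀ n → 3 ≤ n → NullCyclicFlow n 3
nullCyclicFlow n 3≤n with even⊎odd n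
... | inj₁ (k , refl) = evenNullCyclicFlow k (ℕₚ.*-cancelʳ-< 2 1 k 3≤n)
... | inj₂ (m , refl) = oddNullCyclicFlow m (ℕₚ.*-cancelʳ-≤ 1 m 2 (ℕ.s≤s⁻¹ 3≤n))

mainTheorem15 : (n : ℕ) → 3 ≤ n → HasNullOneFactorisation n 3
mainTheorem15 n 3≤n = nullCyclicFlow⇒hasNullOneFactorisation (nullCyclicFlow n 3≤n)
  where
  instance
    n≢0 : NonZero n
    n≢0 = ℕ.>-nonZero (ℕₚ.<-≤-trans ℕ.z<s 3≤n)
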